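{- For every finite set $\Lambda$ of formulas and all finite multisets $\Gamma,\Delta$: if $\Gamma\Rightarrow\Delta$ is provable in $\mathsf{G}^\infty$, then $\Lambda\rhd\bot,\Gamma\Rightarrow\Delta$ is provable in $\mathsf{G}^{\mathrm{fin}}$.
   Context: Formulas: $\phi ::= p \mid \bot \mid \phi\to\phi \mid \phi\rhd\phi$. A sequent $\Gamma\Rightarrow\Delta$ is a pair of finite multisets of formulas; commas denote multiset union; $\Lambda\rhd\bot := \{\lambda\rhd\bot:\lambda\in\Lambda\}$; for formulas $\phi_0,\dots,\phi_{m-1}$, $\Phi_{[0,i)} := \{\phi_0,\dots,\phi_{i-1}\}$. Rules: (ax) $p,\Gamma\Rightarrow p,\Delta$ for a variable $p$; ($\bot$L) $\bot,\Gamma\Rightarrow\Delta$; ($\bot$R) from $\Gamma\Rightarrow\Delta$ infer $\Gamma\Rightarrow\bot,\Delta$; ($\to$L) from $\Gamma\Rightarrow\Delta,\phi$ and $\psi,\Gamma\Rightarrow\Delta$ infer $\phi\to\psi,\Gamma\Rightarrow\Delta$; ($\to$R) from $\phi,\Gamma\Rightarrow\Delta,\psi$ infer $\Gamma\Rightarrow\Delta,\phi\to\psi$; ($\rhd_{\mathsf{IL}}$) for $m\ge0$: from the premises $\psi_i,(\psi_i,\Phi_{[0,i)},\phi)\rhd\bot\Rightarrow\Phi_{[0,i)},\phi$ ($i=0,\dots,m$) infer $\phi_0\rhd\psi_0,\dots,\phi_{m-1}\rhd\psi_{m-1},\Gamma\Rightarrow\psi_m\rhd\phi,\Delta$; ($\rhd_{\mathsf{IK4}}$)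 the same conclusion from the premises $\psi_i,(\Phi_{[0,i)},\phi)\rhd\bot\Rightarrow\Phi_{[0,i)},\phi$ ($i=0,\dots,m$). $\mathsf{G}^{\mathrm{fin}}$: ordinary finite proof trees using ax, $\bot$L, $\bot$R, $\to$L, $\to$R, $\rhd_{\mathsf{IL}}$. $\mathsf{G}^\infty$: a proof is a possibly infinite, finitely branching tree whose nodes are labelled with sequents and rules among ax, $\bot$L, $\bot$R, $\to$L, $\to$R, $\rhd_{\mathsf{IK4}}$, such that each node with its children is an instance of the node's rule (leaves are ax or $\bot$L) and every infinite branch passes infinitely often from the conclusion of a $\rhd_{\mathsf{IK4}}$ instance to one of its premises. -}

module Defs where

open import Data.Nat using (ℕ; zero; suc; _≤_; _<_)
open import Data.List using (List; []; _∷_; _++_; map; take; zipWith; upTo; length)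
open import Data.List.Relation.Binary.Permutation.Propositional using (_↭_)
open import Data.List.Relation.Binary.Pointwise using (Pointwise)
open import Data.List.Relation.Unary.All using (All)
open import Data.Product using (_×_; _,_; proj₁; proj₂; Σ; ∃; ∃-syntax)
open import Relation.Binary.PropositionalEquality using (_≡_)

infixr 6 _⇛_
infixr 7 _▷_
data Formula : Set where
  var : ℕ → Formula
  ⊥f  : Formula
  _⇛_ : Formula → Formula → Formula
  _▷_ : Formula → Formula → Formula

-- Sequents: pairs of finite multisets, represented by lists taken up to permutation.
infix 4 _⇒_
record Sequent : Set where
  constructor _⇒_
  field
    ante : List Formula
    succ : List Formula
open Sequent public

_≈ₛ_ : Sequent → Sequent → Set
(Γ ⇒ Δ) ≈ₛ (Γ' ⇒ Δ') = (Γ ↭ Γ') × (Δ ↭ Δ')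

_▷⊥ : List Formula → List Formula
Λ ▷⊥ = map (λ χ → χ ▷ ⊥f) Λ

data Rule : Set where
  ax botL botR impL impR ▷IL ▷IK4 : Rule

premIL : List Formula → Formula → ℕ → Formula → Sequent
premIL φs φ i ψ = (ψ ∷ ((ψ ∷ (take i φs ++ φ ∷ [])) ▷⊥)) ⇒ (take i φs ++ φ ∷ [])

premIK4 : List Formula → Formula → ℕ → Formula → Sequent
premIK4 φs φ i ψ = (ψ ∷ ((take i φs ++ φ ∷ []) ▷⊥)) ⇒ (take i φs ++ φ ∷ [])

-- The premises i = 0..m, for pairs = [(φ_0,ψ_0),...,(φ_{m-1},ψ_{m-1})], and ψ_m, φ.
premises : (List Formula → Formula → ℕ → Formula → Sequent) →
           List (Formula × Formula) → Formula → Formula → List Sequent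
premises prem pairs ψm φ =
  zipWith (prem (map proj₁ pairs) φ) (upTo (suc (length pairs))) (map proj₂ pairs ++ ψm ∷ [])

boxes : List (Formula × Formula) → List Formula
boxes pairs = map (λ pr → proj₁ pr ▷ proj₂ pr) pairs

data Canon : Rule → Sequent → List Sequent → Set where
  ax   : ∀ p Γ Δ → Canon ax ((var p ∷ Γ) ⇒ (var p ∷ Δ)) []
  botL : ∀ Γ Δ → Canon botL ((⊥f ∷ Γ) ⇒ Δ) []
  botR : ∀ Γ Δ → Canon botR (Γ ⇒ (⊥f ∷ Δ)) ((Γ ⇒ Δ) ∷ [])
  impL : ∀ φ ψ Γ Δ → Canon impL (((φ ⇛ ψ) ∷ Γ) ⇒ Δ)
                         ((Γ ⇒ (φ ∷ Δ)) ∷ ((ψ ∷ Γ) ⇒ Δ) ∷ [])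
  impR : ∀ φ ψ Γ Δ → Canon impR (Γ ⇒ ((φ ⇛ ψ) ∷ Δ)) (((φ ∷ Γ) ⇒ (ψ ∷ Δ)) ∷ [])
  ▷IL  : ∀ pairs ψm φ Γ Δ → Canon ▷IL ((boxes pairs ++ Γ) ⇒ ((ψm ▷ φ) ∷ Δ))
                                  (premises premIL pairs ψm φ)
  ▷IK4 : ∀ pairs ψm φ Γ Δ → Canon ▷IK4 ((boxes pairs ++ Γ) ⇒ ((ψm ▷ φ) ∷ Δ))
                                   (premises premIK4 pairs ψm φ)

Instance : Rule → Sequent → List Sequent → Set
Instance r S ps = ∃[ S' ] ∃[ ps' ] (S ≈ₛ S' × Pointwise _≈ₛ_ ps ps' × Canon r S' ps')

data FinRule : Rule → Set where
  ax : FinRule ax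
  botL : FinRule botL
  botR : FinRule botR
  impL : FinRule impL
  impR : FinRule impR
  ▷IL : FinRule ▷IL

data InfRule : Rule → Set where
  ax : InfRule ax
  botL : InfRule botL
  botR : InfRule botR
  impL : InfRule impL
  impR : InfRule impR
  ▷IK4 : InfRule ▷IK4

data ⊢fin : Sequent → Set where
  node : ∀ {S} (r : Rule) → FinRule r → (ps : List Sequent) →
         Instance r S ps → All ⊢fin ps → ⊢fin S

-- Possibly infinite finitely branching trees: a node is an address (list of child
-- indices, innermost first); child i of node a is  i ∷ a.
data Node (arity : List ℕ → ℕ) : List ℕ → Set where
  root  : Node arity []
  child : ∀ {a} i → Node arity a → i < arity a → Node arity (i ∷ a)

path : (ℕ → ℕ) → ℕ → List ℕ
path β zero = []
path β (suc n) = β n ∷ path β n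

record G∞Proof (S : Sequent) : Set where
  field
    seqAt  : List ℕ → Sequent
    ruleAt : List ℕ → Rule
    arity  : List ℕ → ℕ
    rootSeq : seqAt [] ≡ S
    ruleInf : ∀ a → Node arity a → InfRule (ruleAt a)
    local  : ∀ a → Node arity a →
             Instance (ruleAt a) (seqAt a) (map (λ i → seqAt (i ∷ a)) (upTo (arity a)))
    fair   : (β : ℕ → ℕ) → (∀ n → β n < arity (path β n)) →
             ∀ n → ∃[ m ] (n ≤ m × ruleAt (path β m) ≡ ▷IK4)

⊢∞ : Sequent → Set
⊢∞ S = G∞Proof S

module Submission where

-- A G∞ proof is translated top-down while carrying a list Λ: each sequent Γ ⇒ Δ of the proof
-- is sent to G^fin proofs of Λ ▷ ⊥, Γ ⇒ Δ, Θ for all Θ (written Λ ⊩ Γ ⇒ Δ). Propositional rules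
-- commute with this. A ▷IK4 step becomes a ▷IL step in which each λ ▷ ⊥ is one more principal
-- formula, with ψ = ⊥, so that its premise is an instance of ⊥L. The premise for ψⱼ is an
-- identity sequent if ψⱼ ∈ Λ; otherwise it is, up to permutation, the translation of the ▷IK4
-- premise under ψⱼ ∷ Λ with Θ := Λ, because (ψⱼ ∷ Λ) ▷ ⊥ supplies exactly the diagonal formula
-- ψⱼ ▷ ⊥ that ▷IL adds to ▷IK4.
-- Every formula of the proof lies in the finite list R of subformulas of the root and ⊥, or is
-- χ ▷ ⊥ with χ ∈ R, so the translation terminates by induction on the number of entries of R
-- outside Λ and, within that, on the size of the sequent, which every propositional rule
-- decreases.

open import Defs
open import Data.List using (List; _++_)
open import Data.List.Relation.Unary.Unique.Propositional using (Unique)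

open import Data.Nat using (ℕ; zero; suc; _+_; _≤_; _<_; z≤n; s≤s)
import Data.Nat.Properties as ℕ
open import Data.Nat.ListAction using (sum)
open import Data.Nat.ListAction.Properties using (sum-↭)
open import Data.Nat.Tactic.RingSolver using (solve-∀)
open import Data.List using ([]; _∷_; map; take; zipWith; applyUpTo; length; filter; concatMap)
open import Data.List.Properties using (map-++; ++-assoc; ++-identityʳ)
open import Data.List.Relation.Binary.Permutation.Propositional
  using (_↭_; ↭-refl; ↭-sym; ↭-trans; ↭-reflexive; prep; swap)
open import Data.List.Relation.Binary.Permutation.Propositional.Properties
  using (shift; ++⁺ˡ; ++⁺ʳ; All-resp-↭) renaming (++-comm to ↭-++-comm; map⁺ to ↭-map⁺)
open import Data.List.Relation.Binary.Pointwise using (Pointwise; []; _∷_)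
import Data.List.Relation.Binary.Pointwise as Pointwise
open import Data.List.Relation.Unary.All using (All; []; _∷_)
import Data.List.Relation.Unary.All as All
import Data.List.Relation.Unary.All.Properties as All
import Data.List.Relation.Unary.Any as Any
open import Data.List.Relation.Unary.Any using (here; there)
open import Data.List.Membership.Propositional using (_∈_; _∉_)
open import Data.List.Membership.Propositional.Properties
  using (∈-++⁻; ∈-++⁺ˡ; ∈-++⁺ʳ; ∈-∃++; ∈-map⁻; ∈-upTo⁻; ∈-concatMap⁺; ∈-concatMap⁻)
open import Data.Product using (_×_; _,_; proj₁; proj₂; ∃-syntax)
open import Data.Sum using (_⊎_; inj₁; inj₂)
open import Function using (id; _∘_; _$_)
open import Relation.Nullary using (yes; no; ¬_; ¬?; contradiction)
open import Relation.Nullary.Decidable using (map′; _×-dec_)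
open import Relation.Binary.Core using (_Preserves_⟶_)
open import Relation.Binary.Definitions using (DecidableEquality; _Respects_)
open import Relation.Binary.PropositionalEquality using (_≡_; refl; sym; trans; cong; cong₂; subst)
open import Relation.Unary using (Decidable; _⊆_)

-- Lists

infix 4 _[_]=_
data _[_]=_ {A : Set} : List A → ℕ → A → Set where
  here : ∀ {x xs} → x ∷ xs [ zero ]= x
  there : ∀ {x y xs i} → xs [ i ]= x → y ∷ xs [ suc i ]= x

[]=⇒∈ : ∀ {A : Set} {xs : List A} {i x} → xs [ i ]= x → x ∈ xs
[]=⇒∈ here = here refl
[]=⇒∈ (there at) = there ([]=⇒∈ at)

[]=⇒<length : ∀ {A : Set} {xs : List A} {i x} → xs [ i ]= x → i < length xs
[]=⇒<length here = s≤s z≤n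
[]=⇒<length (there at) = s≤s ([]=⇒<length at)

module _ {A B : Set} (f : ℕ → A → B) where

  All-zipWith-applyUpTo : ∀ {P : B → Set} g n xs → (∀ {i x} → xs [ i ]= x → P (f (g i) x)) →
                          All P (zipWith f (applyUpTo g n) xs)
  All-zipWith-applyUpTo g zero xs Pf = []
  All-zipWith-applyUpTo g (suc n) [] Pf = []
  All-zipWith-applyUpTo g (suc n) (x ∷ xs) Pf =
    Pf here ∷ All-zipWith-applyUpTo (g ∘ suc) n xs (Pf ∘ there)

  ∈-zipWith-applyUpTo : ∀ g n {xs i x} → xs [ i ]= x → i < n → f (g i) x ∈ zipWith f (applyUpTo g n) xs
  ∈-zipWith-applyUpTo g (suc n) here _ = here refl
  ∈-zipWith-applyUpTo g (suc n) (there at) (s≤s i<n) = there (∈-zipWith-applyUpTo (g ∘ suc) n at i<n)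

Pointwise-∈ʳ : ∀ {A B : Set} {R : A → B → Set} {xs ys y} → Pointwise R xs ys → y ∈ ys →
               ∃[ x ] (x ∈ xs × R x y)
Pointwise-∈ʳ (r ∷ _) (here refl) = _ , here refl , r
Pointwise-∈ʳ (_ ∷ rs) (there y∈ys) with x , x∈xs , r ← Pointwise-∈ʳ rs y∈ys = x , there x∈xs , r

module _ {A : Set} {P Q : A → Set} (P? : Decidable P) (Q? : Decidable Q) (P⊆Q : P ⊆ Q) where

  length-filter-mono : ∀ xs → length (filter P? xs) ≤ length (filter Q? xs)
  length-filter-mono [] = z≤n
  length-filter-mono (y ∷ ys) with P? y | Q? y
  ... | yes _ | yes _ = s≤s (length-filter-mono ys)
  ... | yes py | no ¬qy = contradiction (P⊆Q py) ¬qy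
  ... | no _ | yes _ = ℕ.m≤n⇒m≤1+n (length-filter-mono ys)
  ... | no _ | no _ = length-filter-mono ys

  length-filter-strict : ∀ {x xs} → x ∈ xs → Q x → ¬ P x → length (filter P? xs) < length (filter Q? xs)
  length-filter-strict {xs = y ∷ ys} (here refl) qy ¬py with P? y | Q? y
  ... | yes py | _ = contradiction py ¬py
  ... | no _ | yes _ = s≤s (length-filter-mono ys)
  ... | no _ | no ¬qy = contradiction qy ¬qy
  length-filter-strict {xs = y ∷ ys} (there x∈ys) qx ¬px with P? y | Q? y
  ... | yes _ | yes _ = s≤s (length-filter-strict x∈ys qx ¬px)
  ... | yes py | no ¬qy = contradiction (P⊆Q py) ¬qy
  ... | no _ | yes _ = ℕ.m<n⇒m<1+n (length-filter-strict x∈ys qx ¬px)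
  ... | no _ | no _ = length-filter-strict x∈ys qx ¬px

-- Formulas

infix 4 _≟_
_≟_ : DecidableEquality Formula
var m ≟ var n = map′ (cong var) (λ { refl → refl }) (m ℕ.≟ n)
⊥f ≟ ⊥f = yes refl
(a ⇛ b) ≟ (c ⇛ d) = map′ (λ (p , q) → cong₂ _⇛_ p q) (λ { refl → refl , refl }) (a ≟ c ×-dec b ≟ d)
(a ▷ b) ≟ (c ▷ d) = map′ (λ (p , q) → cong₂ _▷_ p q) (λ { refl → refl , refl }) (a ≟ c ×-dec b ≟ d)
var _ ≟ ⊥f = no λ ()
var _ ≟ (_ ⇛ _) = no λ ()
var _ ≟ (_ ▷ _) = no λ ()
⊥f ≟ var _ = no λ ()
⊥f ≟ (_ ⇛ _) = no λ ()
⊥f ≟ (_ ▷ _) = no λ ()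
(_ ⇛ _) ≟ var _ = no λ ()
(_ ⇛ _) ≟ ⊥f = no λ ()
(_ ⇛ _) ≟ (_ ▷ _) = no λ ()
(_ ▷ _) ≟ var _ = no λ ()
(_ ▷ _) ≟ ⊥f = no λ ()
(_ ▷ _) ≟ (_ ⇛ _) = no λ ()

open import Data.List.Membership.DecPropositional _≟_ using (_∈?_)

subformulas : Formula → List Formula
subformulas (var n) = var n ∷ []
subformulas ⊥f = ⊥f ∷ []
subformulas (a ⇛ b) = (a ⇛ b) ∷ subformulas a ++ subformulas b
subformulas (a ▷ b) = (a ▷ b) ∷ subformulas a ++ subformulas b

subformulas-refl : ∀ φ → φ ∈ subformulas φ
subformulas-refl (var n) = here refl
subformulas-refl ⊥f = here refl
subformulas-refl (a ⇛ b) = here refl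
subformulas-refl (a ▷ b) = here refl

mutual
  subformulas-trans : ∀ {φ χ ξ} → χ ∈ subformulas φ → ξ ∈ subformulas χ → ξ ∈ subformulas φ
  subformulas-trans {var _} (here refl) ξ∈χ = ξ∈χ
  subformulas-trans {⊥f} (here refl) ξ∈χ = ξ∈χ
  subformulas-trans {a ⇛ b} (here refl) ξ∈χ = ξ∈χ
  subformulas-trans {a ⇛ b} (there χ∈ab) ξ∈χ = there (subformulas-trans-++ a b χ∈ab ξ∈χ)
  subformulas-trans {a ▷ b} (here refl) ξ∈χ = ξ∈χ
  subformulas-trans {a ▷ b} (there χ∈ab) ξ∈χ = there (subformulas-trans-++ a b χ∈ab ξ∈χ)

  subformulas-trans-++ : ∀ a b {χ ξ} → χ ∈ subformulas a ++ subformulas b → ξ ∈ subformulas χ →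
                         ξ ∈ subformulas a ++ subformulas b
  subformulas-trans-++ a b χ∈ab ξ∈χ with ∈-++⁻ (subformulas a) χ∈ab
  ... | inj₁ χ∈a = ∈-++⁺ˡ (subformulas-trans χ∈a ξ∈χ)
  ... | inj₂ χ∈b = ∈-++⁺ʳ (subformulas a) (subformulas-trans χ∈b ξ∈χ)

SubformulaClosed : List Formula → Set
SubformulaClosed R = ∀ {χ ξ} → χ ∈ R → ξ ∈ subformulas χ → ξ ∈ R

concatMap-subformulas-closed : ∀ L → SubformulaClosed (concatMap subformulas L)
concatMap-subformulas-closed L χ∈R ξ∈χ =
  ∈-concatMap⁺ subformulas
    (Any.map (λ χ∈φ → subformulas-trans χ∈φ ξ∈χ) (∈-concatMap⁻ subformulas {xs = L} χ∈R))

size : Formula → ℕ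
size (var _) = 1
size ⊥f = 1
size (a ⇛ b) = suc (size a + size b)
size (a ▷ b) = suc (size a + size b)

-- Sequents and rules

≈ₛ-refl : ∀ {S} → S ≈ₛ S
≈ₛ-refl = ↭-refl , ↭-refl

≈ₛ-sym : ∀ {S S'} → S ≈ₛ S' → S' ≈ₛ S
≈ₛ-sym (p , q) = ↭-sym p , ↭-sym q

⊢fin-resp-≈ₛ : ⊢fin Respects _≈ₛ_
⊢fin-resp-≈ₛ (p , q) (node r fr ps (S' , ps' , (p' , q') , pw , c) ⊢ps) =
  node r fr ps (S' , ps' , (↭-trans (↭-sym p) p' , ↭-trans (↭-sym q) q') , pw , c) ⊢ps

⊢fin-refl : ∀ φ Γ Δ → ⊢fin ((φ ∷ Γ) ⇒ (φ ∷ Δ))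
⊢fin-refl (var n) Γ Δ = node ax ax [] (_ , _ , ≈ₛ-refl , [] , ax n Γ Δ) []
⊢fin-refl ⊥f Γ Δ = node botL botL [] (_ , _ , ≈ₛ-refl , [] , botL Γ (⊥f ∷ Δ)) []
⊢fin-refl (a ⇛ b) Γ Δ =
  node impR impR _ (_ , _ , ≈ₛ-refl , Pointwise.refl ≈ₛ-refl , impR a b ((a ⇛ b) ∷ Γ) Δ) (⊢a,a⇛b ∷ [])
  where
  ⊢a,a⇛b : ⊢fin ((a ∷ (a ⇛ b) ∷ Γ) ⇒ (b ∷ Δ))
  ⊢a,a⇛b = node impL impL _
    (_ , _ , (swap a (a ⇛ b) ↭-refl , ↭-refl) , Pointwise.refl ≈ₛ-refl , impL a b (a ∷ Γ) (b ∷ Δ))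
    (⊢fin-refl a Γ (b ∷ Δ) ∷ ⊢fin-refl b (a ∷ Γ) Δ ∷ [])
⊢fin-refl (a ▷ b) Γ Δ =
  node ▷IL ▷IL _ (_ , _ , ≈ₛ-refl , Pointwise.refl ≈ₛ-refl , ▷IL ((a , b) ∷ []) a b Γ Δ)
    (⊢fin-refl b _ [] ∷ ⊢fin-refl a _ (b ∷ []) ∷ [])

∈⇒↭∷ : ∀ {x : Formula} {xs} → x ∈ xs → ∃[ ys ] (xs ↭ x ∷ ys)
∈⇒↭∷ {x} x∈xs with ys , zs , refl ← ∈-∃++ x∈xs = ys ++ zs , shift x ys zs

⊢fin-∈ : ∀ {φ Γ Δ} → φ ∈ Γ → φ ∈ Δ → ⊢fin (Γ ⇒ Δ)
⊢fin-∈ {φ} φ∈Γ φ∈Δ with Γ' , Γ↭ ← ∈⇒↭∷ φ∈Γ | Δ' , Δ↭ ← ∈⇒↭∷ φ∈Δ =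
  ⊢fin-resp-≈ₛ (↭-sym Γ↭ , ↭-sym Δ↭) (⊢fin-refl φ Γ' Δ')

weaken : List Formula → List Formula → Sequent → Sequent
weaken Σ Θ S = (Σ ++ ante S) ⇒ (succ S ++ Θ)

weaken-resp-≈ₛ : ∀ Σ Θ → weaken Σ Θ Preserves _≈ₛ_ ⟶ _≈ₛ_
weaken-resp-≈ₛ Σ Θ (p , q) = ++⁺ˡ Σ p , ++⁺ʳ Θ q

data Propositional : Rule → Set where
  ax : Propositional ax
  botL : Propositional botL
  botR : Propositional botR
  impL : Propositional impL
  impR : Propositional impR

Propositional⇒FinRule : ∀ {r} → Propositional r → FinRule r
Propositional⇒FinRule ax = ax
Propositional⇒FinRule botL = botL
Propositional⇒FinRule botR = botR
Propositional⇒FinRule impL = impL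
Propositional⇒FinRule impR = impR

InfRule⇒Propositional⊎▷IK4 : ∀ {r} → InfRule r → Propositional r ⊎ r ≡ ▷IK4
InfRule⇒Propositional⊎▷IK4 ax = inj₁ ax
InfRule⇒Propositional⊎▷IK4 botL = inj₁ botL
InfRule⇒Propositional⊎▷IK4 botR = inj₁ botR
InfRule⇒Propositional⊎▷IK4 impL = inj₁ impL
InfRule⇒Propositional⊎▷IK4 impR = inj₁ impR
InfRule⇒Propositional⊎▷IK4 ▷IK4 = inj₂ refl

weaken-Instance : ∀ {r S ps} → Propositional r → Canon r S ps →
                  ∀ Σ Θ → Instance r (weaken Σ Θ S) (map (weaken Σ Θ) ps)
weaken-Instance _ (ax p Γ Δ) Σ Θ =
  _ , _ , (shift (var p) Σ Γ , ↭-refl) , [] , ax p (Σ ++ Γ) (Δ ++ Θ)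
weaken-Instance _ (botL Γ Δ) Σ Θ =
  _ , _ , (shift ⊥f Σ Γ , ↭-refl) , [] , botL (Σ ++ Γ) (Δ ++ Θ)
weaken-Instance _ (botR Γ Δ) Σ Θ =
  _ , _ , ≈ₛ-refl , Pointwise.refl ≈ₛ-refl , botR (Σ ++ Γ) (Δ ++ Θ)
weaken-Instance _ (impL φ ψ Γ Δ) Σ Θ =
  _ , _ , (shift (φ ⇛ ψ) Σ Γ , ↭-refl) , ≈ₛ-refl ∷ (shift ψ Σ Γ , ↭-refl) ∷ [] ,
  impL φ ψ (Σ ++ Γ) (Δ ++ Θ)
weaken-Instance _ (impR φ ψ Γ Δ) Σ Θ =
  _ , _ , ≈ₛ-refl , (shift φ Σ Γ , ↭-refl) ∷ [] , impR φ ψ (Σ ++ Γ) (Δ ++ Θ)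

weight : Sequent → ℕ
weight S = sum (map size (ante S)) + sum (map size (succ S))

weight-resp-≈ₛ : ∀ {S S'} → S ≈ₛ S' → weight S ≡ weight S'
weight-resp-≈ₛ (p , q) = cong₂ _+_ (sum-↭ (↭-map⁺ size p)) (sum-↭ (↭-map⁺ size q))

premises-lighter : ∀ {r S ps} → Propositional r → Canon r S ps → All (λ p → weight p < weight S) ps
premises-lighter _ (ax p Γ Δ) = []
premises-lighter _ (botL Γ Δ) = []
premises-lighter _ (botR Γ Δ) = ℕ.+-monoʳ-< (sum (map size Γ)) (ℕ.n<1+n _) ∷ []
premises-lighter _ (impL φ ψ Γ Δ) =
  ℕ.≤-trans (ℕ.m≤m+n _ (size ψ)) (ℕ.≤-reflexive (left≡ (size φ) (size ψ) _ _)) ∷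
  ℕ.≤-trans (ℕ.m≤m+n _ (size φ)) (ℕ.≤-reflexive (right≡ (size φ) (size ψ) _ _)) ∷ []
  where
  left≡ : ∀ a b G D → suc (G + (a + D)) + b ≡ suc (a + b) + G + D
  left≡ = solve-∀
  right≡ : ∀ a b G D → suc (b + G + D) + a ≡ suc (a + b) + G + D
  right≡ = solve-∀
premises-lighter _ (impR φ ψ Γ Δ) = ℕ.≤-reflexive (premise≡ (size φ) (size ψ) _ _) ∷ []
  where
  premise≡ : ∀ a b G D → suc (a + G + (b + D)) ≡ G + (suc (a + b) + D)
  premise≡ = solve-∀

ψs : List (Formula × Formula) → Formula → List Formula
ψs pairs ψm = map proj₂ pairs ++ ψm ∷ []

length-ψs : ∀ pairs ψm → length (ψs pairs ψm) ≡ suc (length pairs)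
length-ψs [] ψm = refl
length-ψs (_ ∷ pairs) ψm = cong suc (length-ψs pairs ψm)

All-premises : ∀ {P : Sequent → Set} prem pairs ψm φ →
               (∀ {i x} → ψs pairs ψm [ i ]= x → P (prem (map proj₁ pairs) φ i x)) →
               All P (premises prem pairs ψm φ)
All-premises prem pairs ψm φ = All-zipWith-applyUpTo (prem (map proj₁ pairs) φ) id _ _

premise-∈ : ∀ (prem : List Formula → Formula → ℕ → Formula → Sequent) pairs ψm φ {i x} →
            ψs pairs ψm [ i ]= x → prem (map proj₁ pairs) φ i x ∈ premises prem pairs ψm φ
premise-∈ prem pairs ψm φ at = ∈-zipWith-applyUpTo (prem (map proj₁ pairs) φ) id _ at
  (subst (_ <_) (length-ψs pairs ψm) ([]=⇒<length at))

▷⊥-++ : ∀ xs ys → (xs ++ ys) ▷⊥ ≡ xs ▷⊥ ++ ys ▷⊥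
▷⊥-++ = map-++ (_▷ ⊥f)

▷⊥-pairs : List Formula → List (Formula × Formula)
▷⊥-pairs = map (_, ⊥f)

boxes-▷⊥-pairs : ∀ Λ pairs → boxes (▷⊥-pairs Λ ++ pairs) ≡ Λ ▷⊥ ++ boxes pairs
boxes-▷⊥-pairs [] pairs = refl
boxes-▷⊥-pairs (χ ∷ Λ) pairs = cong ((χ ▷ ⊥f) ∷_) (boxes-▷⊥-pairs Λ pairs)

take-▷⊥-pairs : ∀ Λ pairs j →
                take (length Λ + j) (map proj₁ (▷⊥-pairs Λ ++ pairs)) ≡ Λ ++ take j (map proj₁ pairs)
take-▷⊥-pairs [] pairs j = refl
take-▷⊥-pairs (χ ∷ Λ) pairs j = cong (χ ∷_) (take-▷⊥-pairs Λ pairs j)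

ψs-▷⊥-pairs-[]= : ∀ Λ pairs ψm {i x} → ψs (▷⊥-pairs Λ ++ pairs) ψm [ i ]= x →
                 x ≡ ⊥f ⊎ ∃[ j ] (i ≡ length Λ + j × ψs pairs ψm [ j ]= x)
ψs-▷⊥-pairs-[]= [] pairs ψm at = inj₂ (_ , refl , at)
ψs-▷⊥-pairs-[]= (χ ∷ Λ) pairs ψm here = inj₁ refl
ψs-▷⊥-pairs-[]= (χ ∷ Λ) pairs ψm (there at) with ψs-▷⊥-pairs-[]= Λ pairs ψm at
... | inj₁ x≡⊥ = inj₁ x≡⊥
... | inj₂ (j , refl , at') = inj₂ (j , refl , at')

-- Translating G∞ proofs

infix 3 _⊩_
_⊩_ : List Formula → Sequent → Set
Λ ⊩ S = ∀ Θ → ⊢fin (weaken (Λ ▷⊥) Θ S)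

⊩-resp-≈ₛ : ∀ {Λ} → (Λ ⊩_) Respects _≈ₛ_
⊩-resp-≈ₛ {Λ} S≈S' ⊩S Θ = ⊢fin-resp-≈ₛ (weaken-resp-≈ₛ (Λ ▷⊥) Θ S≈S') (⊩S Θ)

⊩-propositional : ∀ {Λ r S ps} → Propositional r → Canon r S ps → All (Λ ⊩_) ps → Λ ⊩ S
⊩-propositional {Λ} r c ⊩ps Θ =
  node _ (Propositional⇒FinRule r) _ (weaken-Instance r c (Λ ▷⊥) Θ) (All.map⁺ (All.map (_$ Θ) ⊩ps))

⊩-▷IK4 : ∀ {Λ} pairs ψm φ Γ Δ →
         (∀ {j x} → ψs pairs ψm [ j ]= x → x ∉ Λ → (x ∷ Λ) ⊩ premIK4 (map proj₁ pairs) φ j x) →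
         Λ ⊩ (boxes pairs ++ Γ) ⇒ ((ψm ▷ φ) ∷ Δ)
⊩-▷IK4 {Λ} pairs ψm φ Γ Δ ⊩premIK4 Θ =
  node ▷IL ▷IL _
    (_ , _ , (↭-reflexive boxes≡ , ↭-refl) , Pointwise.refl ≈ₛ-refl , ▷IL pairs' ψm φ Γ (Δ ++ Θ))
    (All-premises premIL pairs' ψm φ ⊢premIL)
  where
  pairs' = ▷⊥-pairs Λ ++ pairs
  φs = map proj₁ pairs

  boxes≡ : Λ ▷⊥ ++ boxes pairs ++ Γ ≡ boxes pairs' ++ Γ
  boxes≡ = trans (sym (++-assoc (Λ ▷⊥) (boxes pairs) Γ)) (cong (_++ Γ) (sym (boxes-▷⊥-pairs Λ pairs)))

  diagonal : Formula → List Formula → Sequent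
  diagonal x L = (x ∷ (x ∷ L) ▷⊥) ⇒ L

  ⊢diagonal : ∀ {j x} → ψs pairs ψm [ j ]= x → ⊢fin (diagonal x (Λ ++ take j φs ++ φ ∷ []))
  ⊢diagonal {j} {x} at with x ∈? Λ
  ... | yes x∈Λ = ⊢fin-∈ (here refl) (∈-++⁺ˡ x∈Λ)
  ... | no x∉Λ = ⊢fin-resp-≈ₛ (left↭ , ↭-++-comm T Λ) (⊩premIK4 at x∉Λ Λ)
    where
    T = take j φs ++ φ ∷ []
    left↭ : (x ▷ ⊥f) ∷ Λ ▷⊥ ++ x ∷ T ▷⊥ ↭ x ∷ (x ▷ ⊥f) ∷ (Λ ++ T) ▷⊥
    left↭ = ↭-trans (prep (x ▷ ⊥f) (shift x (Λ ▷⊥) (T ▷⊥)))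
              (↭-trans (swap (x ▷ ⊥f) x ↭-refl)
                (↭-reflexive (cong ((x ∷_) ∘ ((x ▷ ⊥f) ∷_)) (sym (▷⊥-++ Λ T)))))

  ⊢premIL : ∀ {i x} → ψs pairs' ψm [ i ]= x → ⊢fin (premIL (map proj₁ pairs') φ i x)
  ⊢premIL at with ψs-▷⊥-pairs-[]= Λ pairs ψm at
  ... | inj₁ refl = node botL botL [] (_ , _ , ≈ₛ-refl , [] , botL _ _) []
  ... | inj₂ (j , refl , at') = subst (⊢fin ∘ diagonal _) (sym take≡) (⊢diagonal at')
    where
    take≡ : take (length Λ + j) (map proj₁ pairs') ++ φ ∷ [] ≡ Λ ++ take j φs ++ φ ∷ []
    take≡ = trans (cong (_++ φ ∷ []) (take-▷⊥-pairs Λ pairs j)) (++-assoc Λ (take j φs) (φ ∷ []))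

outside : List Formula → List Formula → ℕ
outside Λ R = length (filter (λ χ → ¬? (χ ∈? Λ)) R)

outside-∷ : ∀ {Λ R x} → x ∈ R → x ∉ Λ → outside (x ∷ Λ) R < outside Λ R
outside-∷ {Λ} {x = x} x∈R x∉Λ =
  length-filter-strict (λ χ → ¬? (χ ∈? x ∷ Λ)) (λ χ → ¬? (χ ∈? Λ)) (λ χ∉xΛ → χ∉xΛ ∘ there)
    x∈R x∉Λ (λ x∉xΛ → x∉xΛ (here refl))

data InScope (R : List Formula) : Formula → Set where
  member : ∀ {χ} → χ ∈ R → InScope R χ
  ▷⊥-member : ∀ {χ} → χ ∈ R → InScope R (χ ▷ ⊥f)

InScopeₛ : List Formula → Sequent → Set
InScopeₛ R S = All (InScope R) (ante S) × All (InScope R) (succ S)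

InScopeₛ-resp-≈ₛ : ∀ {R} → InScopeₛ R Respects _≈ₛ_
InScopeₛ-resp-≈ₛ (p , q) (Γ∈ , Δ∈) = All-resp-↭ p Γ∈ , All-resp-↭ q Δ∈

module _ {R : List Formula} (closed : SubformulaClosed R) (⊥∈R : ⊥f ∈ R) where

  ⇛-components : ∀ {a b} → InScope R (a ⇛ b) → a ∈ R × b ∈ R
  ⇛-components {a} {b} (member ab∈R) =
    closed ab∈R (there (∈-++⁺ˡ (subformulas-refl a))) ,
    closed ab∈R (there (∈-++⁺ʳ (subformulas a) (subformulas-refl b)))

  ▷-components : ∀ {a b} → InScope R (a ▷ b) → a ∈ R × b ∈ R
  ▷-components {a} {b} (member ab∈R) =
    closed ab∈R (there (∈-++⁺ˡ (subformulas-refl a))) ,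
    closed ab∈R (there (∈-++⁺ʳ (subformulas a) (subformulas-refl b)))
  ▷-components (▷⊥-member a∈R) = a∈R , ⊥∈R

  boxes-components : ∀ pairs → All (InScope R) (boxes pairs) →
                     All (_∈ R) (map proj₁ pairs) × All (_∈ R) (map proj₂ pairs)
  boxes-components [] [] = [] , []
  boxes-components (_ ∷ pairs) (ab ∷ abs) =
    let a∈R , b∈R = ▷-components ab
        as∈R , bs∈R = boxes-components pairs abs
    in a∈R ∷ as∈R , b∈R ∷ bs∈R

  ▷IK4-components : ∀ pairs ψm φ Γ Δ → InScopeₛ R ((boxes pairs ++ Γ) ⇒ ((ψm ▷ φ) ∷ Δ)) →
                    All (_∈ R) (map proj₁ pairs) × All (_∈ R) (ψs pairs ψm) × φ ∈ R
  ▷IK4-components pairs ψm φ Γ Δ (Γ∈ , ψmφ ∷ _) =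
    let φs∈R , ψs∈R = boxes-components pairs (All.++⁻ˡ (boxes pairs) Γ∈)
        ψm∈R , φ∈R = ▷-components ψmφ
    in φs∈R , All.++⁺ ψs∈R (ψm∈R ∷ []) , φ∈R

  premises-in-scope : ∀ {r S ps} → InfRule r → Canon r S ps → InScopeₛ R S → All (InScopeₛ R) ps
  premises-in-scope ax (ax p Γ Δ) _ = []
  premises-in-scope botL (botL Γ Δ) _ = []
  premises-in-scope botR (botR Γ Δ) (Γ∈ , _ ∷ Δ∈) = (Γ∈ , Δ∈) ∷ []
  premises-in-scope impL (impL φ ψ Γ Δ) (φψ ∷ Γ∈ , Δ∈) =
    let φ∈R , ψ∈R = ⇛-components φψ
    in (Γ∈ , member φ∈R ∷ Δ∈) ∷ (member ψ∈R ∷ Γ∈ , Δ∈) ∷ []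
  premises-in-scope impR (impR φ ψ Γ Δ) (Γ∈ , φψ ∷ Δ∈) =
    let φ∈R , ψ∈R = ⇛-components φψ
    in (member φ∈R ∷ Γ∈ , member ψ∈R ∷ Δ∈) ∷ []
  premises-in-scope ▷IK4 (▷IK4 pairs ψm φ Γ Δ) S∈
    with φs∈R , ψs∈R , φ∈R ← ▷IK4-components pairs ψm φ Γ Δ S∈ =
    All-premises premIK4 pairs ψm φ λ {j} at →
      let T∈R = All.++⁺ (All.take⁺ j φs∈R) (φ∈R ∷ [])
      in member (All.lookup ψs∈R ([]=⇒∈ at)) ∷ All.map⁺ (All.map ▷⊥-member T∈R) , All.map member T∈R

  ⊩-step : ∀ {Λ r S ps} → InfRule r → Canon r S ps → InScopeₛ R S →
           (∀ {p} → p ∈ ps → InScopeₛ R p → weight p < weight S → Λ ⊩ p) →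
           (∀ {p Λ'} → p ∈ ps → InScopeₛ R p → outside Λ' R < outside Λ R → Λ' ⊩ p) →
           Λ ⊩ S
  ⊩-step r c S∈ lighter smaller with InfRule⇒Propositional⊎▷IK4 r | c | premises-in-scope r c S∈
  ... | inj₁ prop | _ | ps∈ =
    ⊩-propositional prop c (All.tabulate λ p∈ps →
      lighter p∈ps (All.lookup ps∈ p∈ps) (All.lookup (premises-lighter prop c) p∈ps))
  ... | inj₂ refl | ▷IK4 pairs ψm φ Γ Δ | ps∈
    with _ , ψs∈R , _ ← ▷IK4-components pairs ψm φ Γ Δ S∈ =
    ⊩-▷IK4 pairs ψm φ Γ Δ λ at x∉Λ →
      let p∈ps = premise-∈ premIK4 pairs ψm φ at
      in smaller p∈ps (All.lookup ps∈ p∈ps) (outside-∷ (All.lookup ψs∈R ([]=⇒∈ at)) x∉Λ)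

module _ {Γ₀ Δ₀ : List Formula} (P : G∞Proof (Γ₀ ⇒ Δ₀)) where
  open G∞Proof P

  R : List Formula
  R = concatMap subformulas (⊥f ∷ Γ₀ ++ Δ₀)

  R-closed : SubformulaClosed R
  R-closed = concatMap-subformulas-closed (⊥f ∷ Γ₀ ++ Δ₀)

  ⊥∈R : ⊥f ∈ R
  ⊥∈R = here refl

  root-in-scope : InScopeₛ R (Γ₀ ⇒ Δ₀)
  root-in-scope = All.tabulate (member ∘ ∈R ∘ ∈-++⁺ˡ) , All.tabulate (member ∘ ∈R ∘ ∈-++⁺ʳ Γ₀)
    where
    ∈R : ∀ {χ} → χ ∈ Γ₀ ++ Δ₀ → χ ∈ R
    ∈R χ∈ = ∈-concatMap⁺ subformulas {xs = ⊥f ∷ Γ₀ ++ Δ₀}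
              (there (Any.map (λ { refl → subformulas-refl _ }) χ∈))

  NodesProvable : List Formula → Set
  NodesProvable Λ = ∀ {a} → Node arity a → InScopeₛ R (seqAt a) → Λ ⊩ seqAt a

  ⊩-node : ∀ {Λ} → (∀ {Λ'} → outside Λ' R < outside Λ R → NodesProvable Λ') →
           ∀ w {a} → Node arity a → weight (seqAt a) < w → InScopeₛ R (seqAt a) → Λ ⊩ seqAt a
  ⊩-node {Λ} ih (suc w) {a} node-a a<w a∈ with local a node-a
  ... | S , ps , a≈S , children≈ps , canon =
    ⊩-resp-≈ₛ (≈ₛ-sym a≈S)
      (⊩-step R-closed ⊥∈R (ruleInf a node-a) canon
        (InScopeₛ-resp-≈ₛ a≈S a∈) lighter smaller)
    where
    child≈ : ∀ {p} → p ∈ ps → ∃[ i ] (Node arity (i ∷ a) × seqAt (i ∷ a) ≈ₛ p)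
    child≈ p∈ps
      with q , q∈ , q≈p ← Pointwise-∈ʳ children≈ps p∈ps
      with i , i∈ , refl ← ∈-map⁻ (λ i → seqAt (i ∷ a)) q∈
      = i , child i node-a (∈-upTo⁻ i∈) , q≈p

    S≤w : weight S ≤ w
    S≤w = ℕ.≤-pred (subst (_< suc w) (weight-resp-≈ₛ a≈S) a<w)

    lighter : ∀ {p} → p ∈ ps → InScopeₛ R p → weight p < weight S → Λ ⊩ p
    lighter p∈ps p∈ p<S with i , node-i , i≈p ← child≈ p∈ps =
      ⊩-resp-≈ₛ i≈p (⊩-node ih w node-i i<w (InScopeₛ-resp-≈ₛ (≈ₛ-sym i≈p) p∈))
      where
      i<w : weight (seqAt (i ∷ a)) < w
      i<w = ℕ.<-≤-trans (subst (_< weight S) (sym (weight-resp-≈ₛ i≈p)) p<S) S≤w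

    smaller : ∀ {p Λ'} → p ∈ ps → InScopeₛ R p → outside Λ' R < outside Λ R → Λ' ⊩ p
    smaller p∈ps p∈ Λ'<Λ with i , node-i , i≈p ← child≈ p∈ps =
      ⊩-resp-≈ₛ i≈p (ih Λ'<Λ node-i (InScopeₛ-resp-≈ₛ (≈ₛ-sym i≈p) p∈))

  ⊩-nodes : ∀ n {Λ} → outside Λ R < n → NodesProvable Λ
  ⊩-nodes (suc n) Λ<n node-a =
    ⊩-node (λ Λ'<Λ → ⊩-nodes n (ℕ.<-≤-trans Λ'<Λ (ℕ.≤-pred Λ<n))) _ node-a (ℕ.n<1+n _)

  ⊩-root : ∀ Λ → Λ ⊩ Γ₀ ⇒ Δ₀
  ⊩-root Λ = subst (Λ ⊩_) rootSeq
    (⊩-nodes _ (ℕ.n<1+n _) root (subst (InScopeₛ R) (sym rootSeq) root-in-scope))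

-- The translation works for every list Λ.
mainTheorem5 : (Λ Γ Δ : List Formula) → Unique Λ →
    ⊢∞ (Γ ⇒ Δ) → ⊢fin ((Λ ▷⊥ ++ Γ) ⇒ Δ)
mainTheorem5 Λ Γ Δ _ P = subst (λ Δ' → ⊢fin ((Λ ▷⊥ ++ Γ) ⇒ Δ')) (++-identityʳ Δ) (⊩-root P Λ [])
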